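{- Let $n\ge 2$, let $A\subseteq[n]$ be nonempty, let $w$ be the largest element of $A$ and $A'=A\setminus\{w\}$. If $1<w<n-1$, then $$f_n(A)=2f_{n-1}(A)+f_{n-1}(A')-\sum_{j=w-1}^{n-2}f_j(A').$$
   Context: The set of alternatives is $[m]=\{1,\dots,m\}$ with its natural order. For a triple $i<j<k$, the never condition $1N3$ on a set of linear orders means that in every order, $i$ is not ranked last among $i,j,k$; $3N1$ means that $k$ is not ranked first among $i,j,k$. For $B\subseteq[m]$, the set-alternating scheme generated by $B$ assigns to each triple $i<j<k$ in $[m]$ the condition $1N3$ if $j\in B$ and $3N1$ if $j\notin B$; $D_{[m]}(B)$ is the set of all linear orders on $[m]$ satisfying all assigned conditions, and $f_m(B)=|D_{[m]}(B)|$. For a set $B$ of positive integers not contained in $[m]$, $f_m(B)$ means $f_m(B\cap[m])$. -}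

module Defs where

open import Data.Bool using (Bool; true; false; if_then_else_; not; _∧_)
open import Data.Nat using (ℕ; zero; suc; _+_; _∸_; _≡ᵇ_; _<ᵇ_)
open import Data.Product using (_×_; _,_)
open import Data.List using (List; []; _∷_; map; concatMap; length; filterᵇ; upTo)
open import Data.Bool.ListAction using (and)
open import Data.Nat.ListAction using (sum)

-- A linear order on [m] is a list containing each of 1..m exactly once,
-- listed from the top-ranked (first) to the bottom-ranked (last) alternative.

range : ℕ → List ℕ
range m = map suc (upTo m)

-- integers a, a+1, ..., b  (empty if b < a)
fromTo : ℕ → ℕ → List ℕ
fromTo a b = map (λ i → a + i) (upTo (suc b ∸ a))

insertAll : ℕ → List ℕ → List (List ℕ)
insertAll x [] = (x ∷ []) ∷ []
insertAll x (y ∷ ys) = (x ∷ y ∷ ys) ∷ map (y ∷_) (insertAll x ys)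

perms : List ℕ → List (List ℕ)
perms [] = [] ∷ []
perms (x ∷ xs) = concatMap (insertAll x) (perms xs)

linearOrders : ℕ → List (List ℕ)
linearOrders m = perms (range m)

rank : ℕ → List ℕ → ℕ
rank x [] = 0
rank x (y ∷ l) = if x ≡ᵇ y then 0 else suc (rank x l)

above : List ℕ → ℕ → ℕ → Bool
above l x y = rank x l <ᵇ rank y l

N13 : List ℕ → ℕ → ℕ → ℕ → Bool
N13 l i j k = not (above l j i ∧ above l k i)

N31 : List ℕ → ℕ → ℕ → ℕ → Bool
N31 l i j k = not (above l k i ∧ above l k j)

cond : (ℕ → Bool) → List ℕ → ℕ → ℕ → ℕ → Bool
cond B l i j k = if B j then N13 l i j k else N31 l i j k

triples : ℕ → List (ℕ × ℕ × ℕ)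
triples m = concatMap (λ i → concatMap (λ j → map (λ k → (i , j , k)) (fromTo (suc j) m)) (fromTo (suc i) m)) (range m)

satisfies : ℕ → (ℕ → Bool) → List ℕ → Bool
satisfies m B l = and (map (λ { (i , j , k) → cond B l i j k }) (triples m))

-- D_[m](B) and f_m(B) = |D_[m](B)|  (B is implicitly intersected with [m])
D : ℕ → (ℕ → Bool) → List (List ℕ)
D m B = filterᵇ (satisfies m B) (linearOrders m)

f : ℕ → (ℕ → Bool) → ℕ
f m B = length (D m B)

sumFromTo : ℕ → ℕ → (ℕ → ℕ) → ℕ
sumFromTo a b g = sum (map g (fromTo a b))

{-# OPTIONS --safe #-}
module Submission where

open import Defs

-- Build an order on [m] by inserting m, m-1, ..., 1, each new alternative x being the smallest so
-- far. The triples whose least element is x only see the position of x among the larger alternatives,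
-- so a valid order σ of {x+1, ..., m} has a set of admissible positions for x; the top one always is,
-- and c(σ) counts the others. After inserting x the new count is determined: if x ∉ B it is c(σ)+1
-- with x on top and 0 elsewhere; if x ∈ B it is 1 with x on top and i at the i-th further admissible
-- position. So Σ_σ g(c(σ)) transforms by  step∉ g c = g(c+1) + c·g(0)  or  step∈ g c = g(1) + Σ_{i=1}^c g(i),
-- and f_m(B) = (step_{B(m)} ⋯ step_{B(1)} 1)(0). For A with maximum w all later steps are step∉ and
-- A, A' agree below w; with h the common value after w-1 steps, f_n(A) and f_j(A') are values at 0 of
-- iterates of step∉ on step∈ h and on h. The recurrence is an identity between such iterates, which
-- follows from  step∉ᵏ g (c+1) - step∉ᵏ g c = g(c+k+1) - g(c+k) + Σ_{i<k} (step∉ⁱ g)(0).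

module Sums where

  open import Data.Bool using (Bool; true; false; if_then_else_; _∧_)
  open import Data.Nat using (ℕ; zero; suc; _+_; _*_; _≤_; _<_; z≤n; s≤s; z<s; s<s)
  open import Data.Nat.Properties using (+-identityʳ; +-comm; *-distribʳ-+)
  open import Data.Nat.ListAction using (sum)
  open import Data.Nat.ListAction.Properties using (sum-++)
  open import Data.Bool.ListAction using (and)
  open import Data.List using (List; []; _∷_; _++_; [_]; map; concatMap; length; filterᵇ; applyUpTo)
  open import Data.List.Properties using (map-++; applyUpTo-∷ʳ)
  open import Data.List.Membership.Propositional using (_∈_)
  open import Data.List.Relation.Unary.Any using (here; there)
  open import Data.List.Relation.Unary.All using (All; []; _∷_)
  open import Function using (_∘_)
  open import Relation.Binary.PropositionalEquality using (_≡_; refl; sym; trans; cong; cong₂; module ≡-Reasoning)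
  open ≡-Reasoning

  indicator : Bool → ℕ
  indicator b = if b then 1 else 0

  count : (ℕ → Bool) → ℕ → ℕ
  count v n = sum (applyUpTo (indicator ∘ v ∘ suc) n)

  if-then-else-0≡indicator-* : ∀ b (k : ℕ) → (if b then k else 0) ≡ indicator b * k
  if-then-else-0≡indicator-* true  k = sym (+-identityʳ k)
  if-then-else-0≡indicator-* false k = refl

  length-filterᵇ : ∀ {A : Set} (P : A → Bool) xs → length (filterᵇ P xs) ≡ sum (map (indicator ∘ P) xs)
  length-filterᵇ P []       = refl
  length-filterᵇ P (x ∷ xs) with P x
  ... | true  = cong suc (length-filterᵇ P xs)
  ... | false = length-filterᵇ P xs

  sum-concatMap : ∀ {A C : Set} (φ : A → ℕ) (h : C → List A) xs →
                  sum (map φ (concatMap h xs)) ≡ sum (map (λ c → sum (map φ (h c))) xs)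
  sum-concatMap φ h []       = refl
  sum-concatMap φ h (x ∷ xs) = begin
    sum (map φ (h x ++ concatMap h xs))               ≡⟨ cong sum (map-++ φ (h x) _) ⟩
    sum (map φ (h x) ++ map φ (concatMap h xs))       ≡⟨ sum-++ (map φ (h x)) _ ⟩
    sum (map φ (h x)) + sum (map φ (concatMap h xs))  ≡⟨ cong (sum (map φ (h x)) +_) (sum-concatMap φ h xs) ⟩
    sum (map φ (h x)) + sum (map (λ c → sum (map φ (h c))) xs) ∎

  and-++ : ∀ xs ys → and (xs ++ ys) ≡ and xs ∧ and ys
  and-++ []           ys = refl
  and-++ (true ∷ xs)  ys = and-++ xs ys
  and-++ (false ∷ xs) ys = refl

  and-concatMap : ∀ {A C : Set} (φ : A → Bool) (h : C → List A) xs →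
                  and (map φ (concatMap h xs)) ≡ and (map (λ c → and (map φ (h c))) xs)
  and-concatMap φ h []       = refl
  and-concatMap φ h (x ∷ xs) = begin
    and (map φ (h x ++ concatMap h xs))               ≡⟨ cong and (map-++ φ (h x) _) ⟩
    and (map φ (h x) ++ map φ (concatMap h xs))       ≡⟨ and-++ (map φ (h x)) _ ⟩
    and (map φ (h x)) ∧ and (map φ (concatMap h xs))  ≡⟨ cong (and (map φ (h x)) ∧_) (and-concatMap φ h xs) ⟩
    and (map φ (h x)) ∧ and (map (λ c → and (map φ (h c))) xs) ∎

  and-map-true : ∀ {A : Set} {φ : A → Bool} {xs} → All (λ x → φ x ≡ true) xs → and (map φ xs) ≡ true
  and-map-true []                   = refl
  and-map-true (φx≡true ∷ φxs≡true) rewrite φx≡true = and-map-true φxs≡true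

  and-map-false : ∀ {A : Set} {φ : A → Bool} {xs x} → x ∈ xs → φ x ≡ false → and (map φ xs) ≡ false
  and-map-false                 (here refl)  φx≡false rewrite φx≡false = refl
  and-map-false {φ = φ} {y ∷ _} (there x∈xs) φx≡false with φ y
  ... | true  = and-map-false x∈xs φx≡false
  ... | false = refl

  sum-applyUpTo-suc : ∀ (φ : ℕ → ℕ) n → sum (applyUpTo φ (suc n)) ≡ sum (applyUpTo φ n) + φ n
  sum-applyUpTo-suc φ n = begin
    sum (applyUpTo φ (suc n))         ≡⟨ cong sum (applyUpTo-∷ʳ φ n) ⟨
    sum (applyUpTo φ n ++ [ φ n ])    ≡⟨ sum-++ (applyUpTo φ n) [ φ n ] ⟩
    sum (applyUpTo φ n) + (φ n + 0)   ≡⟨ cong (sum (applyUpTo φ n) +_) (+-identityʳ (φ n)) ⟩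
    sum (applyUpTo φ n) + φ n         ∎

  sum-applyUpTo-cong : ∀ {φ ψ : ℕ → ℕ} n → (∀ {q} → q < n → φ q ≡ ψ q) → sum (applyUpTo φ n) ≡ sum (applyUpTo ψ n)
  sum-applyUpTo-cong zero    φ≡ψ = refl
  sum-applyUpTo-cong (suc n) φ≡ψ = cong₂ _+_ (φ≡ψ z<s) (sum-applyUpTo-cong n (φ≡ψ ∘ s<s))

  sum-applyUpTo-truncate : ∀ {φ : ℕ → ℕ} {k n} → k ≤ n → (∀ {q} → k ≤ q → q < n → φ q ≡ 0) →
                           sum (applyUpTo φ n) ≡ sum (applyUpTo φ k)
  sum-applyUpTo-truncate {n = zero}      z≤n       φ≡0 = refl
  sum-applyUpTo-truncate {φ} {n = suc n} z≤n       φ≡0 =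
    cong₂ _+_ (φ≡0 z≤n z<s) (sum-applyUpTo-truncate {φ ∘ suc} {n = n} z≤n (λ {q} _ q<n → φ≡0 {suc q} z≤n (s<s q<n)))
  sum-applyUpTo-truncate (s≤s k≤n) φ≡0 = cong (_ +_) (sum-applyUpTo-truncate k≤n (λ k≤q q<n → φ≡0 (s≤s k≤q) (s<s q<n)))

  sum-applyUpTo-*ʳ : ∀ (φ : ℕ → ℕ) k n → sum (applyUpTo (λ q → φ q * k) n) ≡ sum (applyUpTo φ n) * k
  sum-applyUpTo-*ʳ φ k zero    = refl
  sum-applyUpTo-*ʳ φ k (suc n) = trans (cong (φ 0 * k +_) (sum-applyUpTo-*ʳ (φ ∘ suc) k n)) (sym (*-distribʳ-+ k (φ 0) _))

  sum-weighted-by-count : ∀ v (g : ℕ → ℕ) n →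
    sum (applyUpTo (λ p → if v (suc p) then g (count v (suc p)) else 0) n) ≡ sum (applyUpTo (g ∘ suc) (count v n))
  sum-weighted-by-count v g zero    = refl
  sum-weighted-by-count v g (suc n) = begin
    sum (applyUpTo term (suc n))                  ≡⟨ sum-applyUpTo-suc term n ⟩
    sum (applyUpTo term n) + term n               ≡⟨ cong (_+ term n) (sum-weighted-by-count v g n) ⟩
    Σg (count v n) + term n                       ≡⟨ cong (λ c → Σg (count v n) + (if v (suc n) then g c else 0)) count-suc ⟩
    Σg (count v n) + (if v (suc n) then g (count v n + indicator (v (suc n))) else 0)
                                                  ≡⟨ extend (v (suc n)) (count v n) ⟩
    Σg (count v n + indicator (v (suc n)))        ≡⟨ cong Σg count-suc ⟨
    Σg (count v (suc n))                          ∎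
    where
    Σg term : ℕ → ℕ
    Σg c = sum (applyUpTo (g ∘ suc) c)
    term p = if v (suc p) then g (count v (suc p)) else 0
    count-suc : count v (suc n) ≡ count v n + indicator (v (suc n))
    count-suc = sum-applyUpTo-suc (indicator ∘ v ∘ suc) n
    extend : ∀ b c → Σg c + (if b then g (c + indicator b) else 0) ≡ Σg (c + indicator b)
    extend true  c rewrite +-comm c 1 = sym (sum-applyUpTo-suc (g ∘ suc) c)
    extend false c rewrite +-identityʳ c = +-identityʳ (Σg c)

module Intervals where

  open import Data.Nat using (ℕ; zero; suc; _+_; _∸_; _≤_; _<_; z≤n; s≤s)
  open import Data.Nat.Properties
  open import Data.List using ([]; _∷_; map; upTo; applyUpTo)
  open import Data.List.Properties using (map-∘; map-applyUpTo; map-upTo)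
  open import Data.Nat.ListAction using (sum)
  open import Data.List.Membership.Propositional using (_∈_)
  open import Data.List.Membership.Propositional.Properties using (∈-map⁺; ∈-upTo⁺)
  open import Data.List.Relation.Unary.All as All using (All)
  import Data.List.Relation.Unary.All.Properties as All
  open import Data.Product using (_×_; _,_)
  open import Function using (_∘_)
  open import Relation.Binary.PropositionalEquality using (_≡_; refl; trans; cong; cong₂; subst; _≗_; module ≡-Reasoning)

  applyUpTo-cong : ∀ {A : Set} {φ ψ : ℕ → A} → φ ≗ ψ → ∀ n → applyUpTo φ n ≡ applyUpTo ψ n
  applyUpTo-cong φ≗ψ zero    = refl
  applyUpTo-cong φ≗ψ (suc n) = cong₂ _∷_ (φ≗ψ 0) (applyUpTo-cong (φ≗ψ ∘ suc) n)

  fromTo-bounds : ∀ a m → All (λ y → a ≤ y × y ≤ m) (fromTo a m)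
  fromTo-bounds a m = All.map⁺ (All.map bounds (All.all-upTo (suc m ∸ a)))
    where
    bounds : ∀ {i} → i < suc m ∸ a → a ≤ a + i × a + i ≤ m
    bounds {i} i<t = m≤m+n a i , ≤-pred (begin-strict
      a + i            <⟨ +-monoʳ-< a i<t ⟩
      a + (suc m ∸ a)  ≡⟨ m+[n∸m]≡n (<⇒≤ (m∸n≢0⇒n<m {suc m} {a} (>⇒≢ (≤-<-trans z≤n i<t)))) ⟩
      suc m            ∎)
      where open ≤-Reasoning

  ∈-fromTo : ∀ {a m y} → a ≤ y → y ≤ m → y ∈ fromTo a m
  ∈-fromTo {a} {m} a≤y y≤m = subst (_∈ fromTo a m) (m+[n∸m]≡n a≤y) (∈-map⁺ (a +_) (∈-upTo⁺ (∸-monoˡ-< (s≤s y≤m) a≤y)))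

  fromTo-cons : ∀ {a m} → a ≤ m → fromTo a m ≡ a ∷ fromTo (suc a) m
  fromTo-cons {a} {m} a≤m = begin
    map (a +_) (upTo (suc m ∸ a))            ≡⟨ cong (map (a +_) ∘ upTo) (+-∸-assoc 1 a≤m) ⟩
    map (a +_) (upTo (suc (m ∸ a)))          ≡⟨ cong₂ _∷_ (+-identityʳ a) (map-applyUpTo suc (a +_) (m ∸ a)) ⟩
    a ∷ applyUpTo (λ i → a + suc i) (m ∸ a)  ≡⟨ cong (a ∷_) (applyUpTo-cong (+-suc a) (m ∸ a)) ⟩
    a ∷ applyUpTo (suc a +_) (m ∸ a)         ≡⟨ cong (a ∷_) (map-upTo (suc a +_) (m ∸ a)) ⟨
    a ∷ fromTo (suc a) m                     ∎
    where open ≡-Reasoning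

  sumFromTo≡sum-applyUpTo : ∀ a k g → sumFromTo a (a + k) g ≡ sum (applyUpTo (g ∘ (a +_)) (suc k))
  sumFromTo≡sum-applyUpTo a k g = begin
    sum (map g (map (a +_) (upTo (suc (a + k) ∸ a))))  ≡⟨ cong (λ t → sum (map g (map (a +_) (upTo t)))) suc[a+k]∸a≡suc-k ⟩
    sum (map g (map (a +_) (upTo (suc k))))            ≡⟨ cong sum (map-∘ {g = g} {f = a +_} (upTo (suc k))) ⟨
    sum (map (g ∘ (a +_)) (upTo (suc k)))              ≡⟨ cong sum (map-upTo (g ∘ (a +_)) (suc k)) ⟩
    sum (applyUpTo (g ∘ (a +_)) (suc k))               ∎
    where
    open ≡-Reasoning
    suc[a+k]∸a≡suc-k : suc (a + k) ∸ a ≡ suc k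
    suc[a+k]∸a≡suc-k = trans (+-∸-assoc 1 (m≤m+n a k)) (cong suc (m+n∸m≡n a k))

  fromTo-empty : ∀ m → fromTo (suc m) m ≡ []
  fromTo-empty m = cong (map (suc m +_) ∘ upTo) (n∸n≡0 m)

module Insertion where

  open import Data.Bool using (true; false)
  open import Data.Nat using (ℕ; zero; suc; _≤_; _<_; z≤n; s≤s; _≡ᵇ_; _<ᵇ_)
  open import Data.List using (List; []; _∷_; map; length; applyUpTo)
  open import Data.List.Properties using (map-applyUpTo)
  open import Data.List.Relation.Unary.All as All using (All; []; _∷_)
  import Data.List.Relation.Unary.All.Properties as All
  open import Function using (_∘_)
  open import Relation.Binary.PropositionalEquality using (_≡_; _≢_; refl; sym; trans; cong; subst)
  open import Relation.Nullary using (contradiction)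

  <ᵇ-true : ∀ {m n} → m < n → (m <ᵇ n) ≡ true
  <ᵇ-true {zero}  {suc n} _         = refl
  <ᵇ-true {suc m} {suc n} (s≤s m<n) = <ᵇ-true m<n

  <ᵇ-false : ∀ {m n} → n ≤ m → (m <ᵇ n) ≡ false
  <ᵇ-false {m}     {zero}  _         = refl
  <ᵇ-false {suc m} {suc n} (s≤s n≤m) = <ᵇ-false n≤m

  ≡ᵇ-refl : ∀ m → (m ≡ᵇ m) ≡ true
  ≡ᵇ-refl zero    = refl
  ≡ᵇ-refl (suc m) = ≡ᵇ-refl m

  ≡ᵇ-false : ∀ {m n} → m ≢ n → (m ≡ᵇ n) ≡ false
  ≡ᵇ-false {zero}  {zero}  m≢n = contradiction refl m≢n
  ≡ᵇ-false {zero}  {suc n} _   = refl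
  ≡ᵇ-false {suc m} {zero}  _   = refl
  ≡ᵇ-false {suc m} {suc n} m≢n = ≡ᵇ-false (m≢n ∘ cong suc)

  insertAt : ℕ → ℕ → List ℕ → List ℕ
  insertAt zero    x σ       = x ∷ σ
  insertAt (suc p) x []      = x ∷ []
  insertAt (suc p) x (y ∷ σ) = y ∷ insertAt p x σ

  length-insertAt : ∀ p x σ → length (insertAt p x σ) ≡ suc (length σ)
  length-insertAt zero    x σ       = refl
  length-insertAt (suc p) x []      = refl
  length-insertAt (suc p) x (y ∷ σ) = cong suc (length-insertAt p x σ)

  insertAll≡applyUpTo-insertAt : ∀ x σ → insertAll x σ ≡ applyUpTo (λ p → insertAt p x σ) (suc (length σ))
  insertAll≡applyUpTo-insertAt x []      = refl
  insertAll≡applyUpTo-insertAt x (y ∷ σ) = cong ((x ∷ y ∷ σ) ∷_) (trans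
    (cong (map (y ∷_)) (insertAll≡applyUpTo-insertAt x σ))
    (map-applyUpTo (λ p → insertAt p x σ) (y ∷_) (suc (length σ))))

  All-insertAt : ∀ {P : ℕ → Set} p {x σ} → P x → All P σ → All P (insertAt p x σ)
  All-insertAt zero    px pσ        = px ∷ pσ
  All-insertAt (suc p) px []        = px ∷ []
  All-insertAt (suc p) px (py ∷ pσ) = py ∷ All-insertAt p px pσ

  All-perms : ∀ {P : ℕ → Set} {xs} → All P xs → All (All P) (perms xs)
  All-perms []                       = [] ∷ []
  All-perms {xs = x ∷ xs} (px ∷ pxs) = All.concat⁺ (All.map⁺ (All.map inserted (All-perms pxs)))
    where
    inserted : ∀ {σ} → All _ σ → All (All _) (insertAll x σ)
    inserted {σ} pσ = subst (All (All _)) (sym (insertAll≡applyUpTo-insertAt x σ))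
      (All.applyUpTo⁺₂ _ _ (λ p → All-insertAt p px pσ))

  shift : ℕ → ℕ → ℕ
  shift zero    r       = suc r
  shift (suc p) zero    = zero
  shift (suc p) (suc r) = suc (shift p r)

  rank-head : ∀ x σ → rank x (x ∷ σ) ≡ 0
  rank-head x σ rewrite ≡ᵇ-refl x = refl

  rank-insertAt : ∀ p x σ {y} → p ≤ length σ → (y ≡ᵇ x) ≡ false → rank y (insertAt p x σ) ≡ shift p (rank y σ)
  rank-insertAt zero    x σ           _        y≢x rewrite y≢x = refl
  rank-insertAt (suc p) x (z ∷ σ) {y} (s≤s p≤) y≢x with y ≡ᵇ z
  ... | true  = refl
  ... | false = cong suc (rank-insertAt p x σ p≤ y≢x)

  rank-insertAt-self : ∀ p x σ → p ≤ length σ → All (λ z → (x ≡ᵇ z) ≡ false) σ → rank x (insertAt p x σ) ≡ p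
  rank-insertAt-self zero    x σ       _        _ = rank-head x σ
  rank-insertAt-self (suc p) x (z ∷ σ) (s≤s p≤) (x≢z ∷ x≢σ) rewrite x≢z = cong suc (rank-insertAt-self p x σ p≤ x≢σ)

  shift-<ᵇ-shift : ∀ p a b → (shift p a <ᵇ shift p b) ≡ (a <ᵇ b)
  shift-<ᵇ-shift zero    a       b       = refl
  shift-<ᵇ-shift (suc p) zero    zero    = refl
  shift-<ᵇ-shift (suc p) zero    (suc b) = refl
  shift-<ᵇ-shift (suc p) (suc a) zero    = refl
  shift-<ᵇ-shift (suc p) (suc a) (suc b) = shift-<ᵇ-shift p a b

  shift-<ᵇ-≤ : ∀ {p q} r → q ≤ p → (shift p r <ᵇ q) ≡ (r <ᵇ q)
  shift-<ᵇ-≤ r       z≤n       = refl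
  shift-<ᵇ-≤ zero    (s≤s q≤p) = refl
  shift-<ᵇ-≤ (suc r) (s≤s q≤p) = shift-<ᵇ-≤ r q≤p

module Transfer where

  open Sums using (sum-applyUpTo-suc; sum-applyUpTo-cong)
  open import Data.Bool using (Bool; true; false)
  open import Data.Nat using (ℕ; zero; suc; _+_; _*_; _≤_; _<_; s≤s)
  open import Data.Nat.Properties using (+-suc; +-identityʳ; +-comm; +-assoc; +-cancelʳ-≡; ≤-refl; m≤n⇒m≤1+n; m≤m+n)
  open import Data.Nat.GeneralisedArithmetic using (fold)
  open import Data.Nat.ListAction using (sum)
  open import Data.Nat.Tactic.RingSolver using (solve-∀)
  open import Data.List using (applyUpTo)
  open import Function using (_∘_)
  open import Relation.Binary.PropositionalEquality using (_≡_; refl; sym; trans; cong; cong₂; _≗_; module ≡-Reasoning)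
  open ≡-Reasoning

  step∉ : (ℕ → ℕ) → ℕ → ℕ
  step∉ g c = g (suc c) + c * g 0

  step∈ : (ℕ → ℕ) → ℕ → ℕ
  step∈ g c = g 1 + sum (applyUpTo (g ∘ suc) c)

  step : Bool → (ℕ → ℕ) → ℕ → ℕ
  step false = step∉
  step true  = step∈

  step-cong : ∀ b {g h : ℕ → ℕ} → g ≗ h → step b g ≗ step b h
  step-cong false g≗h c = cong₂ (λ u v → u + c * v) (g≗h (suc c)) (g≗h 0)
  step-cong true  g≗h c = cong₂ _+_ (g≗h 1) (sum-applyUpTo-cong c (λ _ → g≗h _))

  step∈-suc : ∀ g c → step∈ g (suc c) ≡ step∈ g c + g (suc c)
  step∈-suc g c = begin
    g 1 + sum (applyUpTo (g ∘ suc) (suc c))          ≡⟨ cong (g 1 +_) (sum-applyUpTo-suc (g ∘ suc) c) ⟩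
    g 1 + (sum (applyUpTo (g ∘ suc) c) + g (suc c))  ≡⟨ +-assoc (g 1) _ _ ⟨
    step∈ g c + g (suc c)                            ∎

  fold-step∉-cong : ∀ {g h : ℕ → ℕ} k → g ≗ h → fold g step∉ k ≗ fold h step∉ k
  fold-step∉-cong zero    g≗h = g≗h
  fold-step∉-cong (suc k) g≗h = step-cong false (fold-step∉-cong k g≗h)

  sumIterates : (ℕ → ℕ) → ℕ → ℕ
  sumIterates g k = sum (applyUpTo (λ i → fold g step∉ i 0) k)

  fold-step∉-increment : ∀ g k c → fold g step∉ k (suc c) + g (c + k) ≡ fold g step∉ k c + g (suc (c + k)) + sumIterates g k
  fold-step∉-increment g zero    c rewrite +-identityʳ c = trans (+-comm (g (suc c)) (g c)) (sym (+-identityʳ _))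
  fold-step∉-increment g (suc k) c rewrite +-suc c k = begin
    X₂ + (Z + c * Z) + y₁        ≡⟨ move-y X₂ Z c y₁ ⟩
    (X₂ + y₁) + (Z + c * Z)      ≡⟨ cong (_+ (Z + c * Z)) (fold-step∉-increment g k (suc c)) ⟩
    (X₁ + y₂ + S) + (Z + c * Z)  ≡⟨ move-Z X₁ y₂ S Z c ⟩
    X₁ + c * Z + y₂ + (S + Z)    ≡⟨ cong (X₁ + c * Z + y₂ +_) (sum-applyUpTo-suc (λ i → fold g step∉ i 0) k) ⟨
    X₁ + c * Z + y₂ + sumIterates g (suc k) ∎
    where
    X₁ = fold g step∉ k (suc c)
    X₂ = fold g step∉ k (suc (suc c))
    Z  = fold g step∉ k 0
    y₁ = g (suc (c + k))
    y₂ = g (suc (suc (c + k)))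
    S  = sumIterates g k
    move-y : ∀ x z c y → x + (z + c * z) + y ≡ (x + y) + (z + c * z)
    move-y = solve-∀
    move-Z : ∀ x y s z c → (x + y + s) + (z + c * z) ≡ x + c * z + y + (s + z)
    move-Z = solve-∀

  fold-step∉-suc-at-0 : ∀ g k → fold g step∉ (suc k) 0 + g k ≡ fold g step∉ k 0 + g (suc k) + sumIterates g k
  fold-step∉-suc-at-0 g k = trans (cong (_+ g k) (+-identityʳ _)) (fold-step∉-increment g k 0)

  private
    combine : ∀ {a₀ a₁ h₁ h₂ s r₁ r₂ t} → a₁ ≡ a₀ + h₁ + s → r₂ + h₁ ≡ r₁ + h₂ + t →
              a₁ + h₂ + (s + a₀) + (t + r₁) ≡ 2 * a₁ + r₂
    combine {a₀} {_} {h₁} {h₂} {s} {r₁} {r₂} {t} refl r₂+h₁≡ = +-cancelʳ-≡ h₁ _ _ (begin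
      a₁ + h₂ + (s + a₀) + (t + r₁) + h₁  ≡⟨ regroup a₀ h₁ h₂ s r₁ t ⟩
      2 * a₁ + (r₁ + h₂ + t)              ≡⟨ cong (2 * a₁ +_) r₂+h₁≡ ⟨
      2 * a₁ + (r₂ + h₁)                  ≡⟨ +-assoc (2 * a₁) r₂ h₁ ⟨
      2 * a₁ + r₂ + h₁                    ∎)
      where
      a₁ = a₀ + h₁ + s
      regroup : ∀ a₀ h₁ h₂ s r₁ t → let a₁ = a₀ + h₁ + s in
                a₁ + h₂ + (s + a₀) + (t + r₁) + h₁ ≡ 2 * a₁ + (r₁ + h₂ + t)
      regroup = solve-∀

  step∈-iterate-identity : ∀ h M → fold (step∈ h) step∉ (2 + M) 0 + sumIterates h (2 + M)
                                   ≡ 2 * fold (step∈ h) step∉ (1 + M) 0 + fold h step∉ (2 + M) 0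
  step∈-iterate-identity h M = begin
    a (2 + M) + sumIterates h (2 + M)
      ≡⟨ cong₂ _+_ (a-suc (1 + M)) (sum-applyUpTo-suc r (1 + M)) ⟩
    a (1 + M) + h (2 + M) + sumIterates (step∈ h) (1 + M) + (sumIterates h (1 + M) + r (1 + M))
      ≡⟨ cong (λ u → a (1 + M) + h (2 + M) + u + (sumIterates h (1 + M) + r (1 + M))) (sum-applyUpTo-suc a M) ⟩
    a (1 + M) + h (2 + M) + (sumIterates (step∈ h) M + a M) + (sumIterates h (1 + M) + r (1 + M))
      ≡⟨ combine {a₀ = a M} {s = sumIterates (step∈ h) M} {r₁ = r (1 + M)} {t = sumIterates h (1 + M)}
                 (a-suc M) (fold-step∉-suc-at-0 h (1 + M)) ⟩
    2 * a (1 + M) + r (2 + M) ∎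
    where
    a r : ℕ → ℕ
    a k = fold (step∈ h) step∉ k 0
    r k = fold h step∉ k 0
    a-suc : ∀ k → a (suc k) ≡ a k + h (suc k) + sumIterates (step∈ h) k
    a-suc k = +-cancelʳ-≡ (step∈ h k) _ _ (begin
      a (suc k) + step∈ h k              ≡⟨ fold-step∉-suc-at-0 (step∈ h) k ⟩
      a k + step∈ h (suc k) + S          ≡⟨ cong (λ u → a k + u + S) (step∈-suc h k) ⟩
      a k + (step∈ h k + h (suc k)) + S  ≡⟨ move (a k) (step∈ h k) (h (suc k)) S ⟩
      a k + h (suc k) + S + step∈ h k    ∎)
      where
      S = sumIterates (step∈ h) k
      move : ∀ a p x s → a + (p + x) + s ≡ a + x + s + p
      move = solve-∀

  transfer : (ℕ → Bool) → ℕ → ℕ → ℕ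
  transfer B zero    = λ _ → 1
  transfer B (suc k) = step (B (suc k)) (transfer B k)

  transfer-cong : ∀ {B B′ : ℕ → Bool} k → (∀ {i} → i ≤ k → B i ≡ B′ i) → transfer B k ≗ transfer B′ k
  transfer-cong zero                B≡B′ c = refl
  transfer-cong {B} {B′} (suc k) B≡B′ c = trans (step-cong (B (suc k)) (transfer-cong k (B≡B′ ∘ m≤n⇒m≤1+n)) c)
                                                (cong (λ b → step b (transfer B′ k) c) (B≡B′ ≤-refl))

  transfer-beyond : ∀ {B : ℕ → Bool} j k → (∀ {i} → j < i → B i ≡ false) → transfer B (j + k) ≗ fold (transfer B j) step∉ k
  transfer-beyond     j zero    B≡false rewrite +-identityʳ j = λ _ → refl
  transfer-beyond {B} j (suc k) B≡false rewrite +-suc j k = λ c →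
    trans (cong (λ b → step b (transfer B (j + k)) c) (B≡false (s≤s (m≤m+n j k))))
          (step-cong false (transfer-beyond j k B≡false) c)

module Counting where

  open Sums
  open Intervals
  open Insertion
  open Transfer using (step; transfer)
  open import Data.Bool using (Bool; true; false; if_then_else_; not; _∧_)
  open import Data.Bool.Properties using (∧-zeroʳ; ∧-identityʳ)
  open import Data.Nat using (ℕ; zero; suc; _+_; _*_; _≤_; _<_; z≤n; s≤s; _<ᵇ_)
  open import Data.Nat.Properties
  open import Data.Nat.ListAction using (sum)
  open import Data.Bool.ListAction using (and)
  open import Data.List using (List; []; _∷_; map; concatMap; length; applyUpTo)
  open import Data.List.Properties using (map-cong; map-cong-local; map-∘; map-applyUpTo)
  open import Data.List.Membership.Propositional using (_∈_)
  open import Data.List.Relation.Unary.All as All using (All; []; _∷_)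
  open import Data.Product using (_×_; _,_; proj₁; proj₂)
  open import Function using (_∘_)
  open import Relation.Binary.PropositionalEquality using (_≡_; refl; sym; trans; cong; cong₂; subst; module ≡-Reasoning)
  open ≡-Reasoning

  -- cond B l i j k unfolds to schemeCond (B j) (above l j i) (above l k i) (above l k j).
  schemeCond : Bool → Bool → Bool → Bool → Bool
  schemeCond b j≻i k≻i k≻j = if b then not (j≻i ∧ k≻i) else not (k≻i ∧ k≻j)

  cong₃ : ∀ {A C D E : Set} (f : A → C → D → E) {a a′ c c′ d d′} → a ≡ a′ → c ≡ c′ → d ≡ d′ → f a c d ≡ f a′ c′ d′
  cong₃ f refl refl refl = refl

  module SchemeCounting (B : ℕ → Bool) (m : ℕ) where

    -- The condition of a triple x < j < k when x is inserted at position p of the order σ of larger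
    -- alternatives: j ends up above x iff rank j σ < p.
    slotPair : List ℕ → ℕ → ℕ → ℕ → Bool
    slotPair σ p j k = schemeCond (B j) (rank j σ <ᵇ p) (rank k σ <ᵇ p) (rank k σ <ᵇ rank j σ)

    slotRow : List ℕ → ℕ → ℕ → Bool
    slotRow σ p j = and (map (slotPair σ p j) (fromTo (suc j) m))

    okSlot : ℕ → List ℕ → ℕ → Bool
    okSlot a σ p = and (map (slotRow σ p) (fromTo a m))

    -- The triples with least element i are those of i inserted at its own position among the larger ones.
    okFrom : ℕ → List ℕ → Bool
    okFrom a σ = and (map (λ i → okSlot (suc i) σ (rank i σ)) (fromTo a m))

    Bounded : ℕ → List ℕ → Set
    Bounded x σ = All (λ y → x < y × y ≤ m) σ

    -- Position 0 is always admissible (okSlot-zero) and is not counted.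
    nOkSlots : ℕ → List ℕ → ℕ
    nOkSlots a σ = count (okSlot a σ) (length σ)

    weight : ℕ → (ℕ → ℕ) → List ℕ → ℕ
    weight a g σ = if okFrom a σ then g (nOkSlots a σ) else 0

    weightedCount : ℕ → (ℕ → ℕ) → ℕ
    weightedCount a g = sum (map (weight a g) (perms (fromTo a m)))

    okSlot-cong : ∀ a σ σ′ q q′ → (∀ {j k} → a ≤ j → j < k → slotPair σ q j k ≡ slotPair σ′ q′ j k) →
                  okSlot a σ q ≡ okSlot a σ′ q′
    okSlot-cong a σ σ′ q q′ pair≡ = cong and (map-cong-local (All.map
      (λ {j} (a≤j , _) → cong and (map-cong-local (All.map (λ (j<k , _) → pair≡ a≤j j<k) (fromTo-bounds (suc j) m))))
      (fromTo-bounds a m)))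

    okSlot-zero : ∀ a σ → okSlot a σ 0 ≡ true
    okSlot-zero a σ = and-map-true (All.map (λ {j} _ → and-map-true (All.map (λ {k} _ → schemeCond-ff (B j) {rank k σ <ᵇ rank j σ})
                                                                            (fromTo-bounds (suc j) m)))
                                            (fromTo-bounds a m))
      where
      schemeCond-ff : ∀ b {w} → schemeCond b false false w ≡ true
      schemeCond-ff true  = refl
      schemeCond-ff false = refl

    okSlot-cons : ∀ {x} σ q → x ≤ m → okSlot x σ q ≡ slotRow σ q x ∧ okSlot (suc x) σ q
    okSlot-cons σ q x≤m = cong (and ∘ map (slotRow σ q)) (fromTo-cons x≤m)

    okFrom-cons : ∀ {x} σ → x ≤ m → okFrom x σ ≡ okSlot (suc x) σ (rank x σ) ∧ okFrom (suc x) σ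
    okFrom-cons σ x≤m = cong (and ∘ map (λ i → okSlot (suc i) σ (rank i σ))) (fromTo-cons x≤m)

    module Inserted {x σ} (σ-bounds : Bounded x σ) {p} (p≤ : p ≤ length σ) where

      σ′ : List ℕ
      σ′ = insertAt p x σ

      rank-x : rank x σ′ ≡ p
      rank-x = rank-insertAt-self p x σ p≤ (All.map (λ (x<z , _) → ≡ᵇ-false (<⇒≢ x<z)) σ-bounds)

      rank-above : ∀ {y} → x < y → rank y σ′ ≡ shift p (rank y σ)
      rank-above x<y = rank-insertAt p x σ p≤ (≡ᵇ-false (>⇒≢ x<y))

      okSlot-insertAt : ∀ {a} q q′ → x < a → (∀ r → (shift p r <ᵇ q′) ≡ (r <ᵇ q)) → okSlot a σ′ q′ ≡ okSlot a σ q
      okSlot-insertAt {a} q q′ x<a threshold = okSlot-cong a σ′ σ q′ q λ {j} {k} a≤j j<k →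
        let x<j = <-≤-trans x<a a≤j ; x<k = <-trans x<j j<k in
        cong₃ (schemeCond (B j))
          (trans (cong (_<ᵇ q′) (rank-above x<j)) (threshold (rank j σ)))
          (trans (cong (_<ᵇ q′) (rank-above x<k)) (threshold (rank k σ)))
          (trans (cong₂ _<ᵇ_ (rank-above x<k) (rank-above x<j)) (shift-<ᵇ-shift p (rank k σ) (rank j σ)))

      okFrom-insertAt : x ≤ m → okFrom x σ′ ≡ okSlot (suc x) σ p ∧ okFrom (suc x) σ
      okFrom-insertAt x≤m = trans (okFrom-cons σ′ x≤m) (cong₂ _∧_
        (trans (cong (okSlot (suc x) σ′) rank-x) (okSlot-insertAt p p ≤-refl (λ r → shift-<ᵇ-≤ {p} r ≤-refl)))
        (cong and (map-cong-local (All.map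
          (λ {i} (x<i , _) → trans (cong (okSlot (suc i) σ′) (rank-above x<i))
                                    (okSlot-insertAt (rank i σ) (shift p (rank i σ)) (m≤n⇒m≤1+n x<i)
                                                     (λ r → shift-<ᵇ-shift p r (rank i σ))))
          (fromTo-bounds (suc x) m)))))

      slotRow-below : B x ≡ true → ∀ {q} → q ≤ p → slotRow σ′ q x ≡ true
      slotRow-below Bx {q} q≤p = and-map-true (All.map (λ {k} _ → pair k) (fromTo-bounds (suc x) m))
        where
        pair : ∀ k → slotPair σ′ q x k ≡ true
        pair k rewrite Bx | rank-x | <ᵇ-false q≤p = refl

    slotRow-head-∉ : ∀ {x} σ q → B x ≡ false → slotRow (x ∷ σ) q x ≡ true
    slotRow-head-∉ {x} σ q Bx = and-map-true (All.map (λ {k} _ → pair k) (fromTo-bounds (suc x) m))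
      where
      pair : ∀ k → slotPair (x ∷ σ) q x k ≡ true
      pair k rewrite Bx | rank-head x σ = cong not (∧-zeroʳ (rank k (x ∷ σ) <ᵇ q))

    slotRow-head-∈ : ∀ {x} σ → B x ≡ true → slotRow (x ∷ σ) 1 x ≡ true
    slotRow-head-∈ {x} σ Bx = and-map-true (All.map (λ {k} (x<k , _) → pair x<k) (fromTo-bounds (suc x) m))
      where
      pair : ∀ {k} → x < k → slotPair (x ∷ σ) 1 x k ≡ true
      pair {k} x<k rewrite Bx | rank-head x σ | ≡ᵇ-false (>⇒≢ x<k) = refl

    slotRow-head-∈-late : ∀ {x z} σ q → B x ≡ true → x < z → z ≤ m → slotRow (x ∷ z ∷ σ) (2 + q) x ≡ false
    slotRow-head-∈-late {x} {z} σ q Bx x<z z≤m = and-map-false (∈-fromTo x<z z≤m) pair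
      where
      pair : slotPair (x ∷ z ∷ σ) (2 + q) x z ≡ false
      pair rewrite Bx | rank-head x (z ∷ σ) | ≡ᵇ-false (>⇒≢ x<z) | rank-head z σ = refl

    module _ {x z σ} (σ-bounds : Bounded x (z ∷ σ)) {p} (p< : suc p ≤ length (z ∷ σ)) where

      private
        x<z : x < z
        x<z = proj₁ (All.head σ-bounds)
        z∈ : z ∈ fromTo (suc x) m
        z∈ = ∈-fromTo x<z (proj₂ (All.head σ-bounds))
        rank-x : rank x (insertAt (suc p) x (z ∷ σ)) ≡ suc p
        rank-x = Inserted.rank-x σ-bounds p<

      slotRow-later-∉ : B x ≡ false → ∀ q → slotRow (insertAt (suc p) x (z ∷ σ)) (suc q) x ≡ false
      slotRow-later-∉ Bx q = and-map-false z∈ pair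
        where
        pair : slotPair (insertAt (suc p) x (z ∷ σ)) (suc q) x z ≡ false
        pair rewrite Bx | rank-x | rank-head z (insertAt p x σ) = refl

      slotRow-later-∈ : B x ≡ true → ∀ {q} → p < q → slotRow (insertAt (suc p) x (z ∷ σ)) (suc q) x ≡ false
      slotRow-later-∈ Bx {q} p<q = and-map-false z∈ pair
        where
        pair : slotPair (insertAt (suc p) x (z ∷ σ)) (suc q) x z ≡ false
        pair rewrite Bx | rank-x | rank-head z (insertAt p x σ) | <ᵇ-true p<q = refl

    module _ {x} (x≤m : x ≤ m) where

      nOkSlots-head-∉ : ∀ {σ} → Bounded x σ → B x ≡ false → nOkSlots x (x ∷ σ) ≡ suc (nOkSlots (suc x) σ)
      nOkSlots-head-∉ {σ} σ-bounds Bx =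
        trans (sum-applyUpTo-cong (suc (length σ)) (λ {q} _ → cong indicator (slot q)))
              (cong (_+ nOkSlots (suc x) σ) (cong indicator (okSlot-zero (suc x) σ)))
        where
        slot : ∀ q → okSlot x (x ∷ σ) (suc q) ≡ okSlot (suc x) σ q
        slot q = trans (okSlot-cons (x ∷ σ) (suc q) x≤m)
          (cong₂ _∧_ (slotRow-head-∉ σ (suc q) Bx) (Inserted.okSlot-insertAt σ-bounds z≤n q (suc q) ≤-refl (λ _ → refl)))

      okSlot-head-∈ : ∀ {σ} → Bounded x σ → B x ≡ true → okSlot x (x ∷ σ) 1 ≡ true
      okSlot-head-∈ {σ} σ-bounds Bx = trans (okSlot-cons (x ∷ σ) 1 x≤m)
        (cong₂ _∧_ (slotRow-head-∈ σ Bx)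
                   (trans (Inserted.okSlot-insertAt σ-bounds z≤n 0 1 ≤-refl (λ _ → refl)) (okSlot-zero (suc x) σ)))

      nOkSlots-head-∈ : ∀ σ → Bounded x σ → B x ≡ true → nOkSlots x (x ∷ σ) ≡ 1
      nOkSlots-head-∈ []         σ-bounds Bx = cong (_+ 0) (cong indicator (okSlot-head-∈ σ-bounds Bx))
      nOkSlots-head-∈ σ@(z ∷ σ₀) σ-bounds@((x<z , z≤m) ∷ _) Bx = cong₂ _+_ (cong indicator (okSlot-head-∈ σ-bounds Bx))
        (sum-applyUpTo-truncate {λ q → indicator (okSlot x (x ∷ σ) (2 + q))} {n = length σ} z≤n λ {q} _ _ →
          cong indicator (trans (okSlot-cons (x ∷ σ) (2 + q) x≤m)
                                (cong (_∧ okSlot (suc x) (x ∷ σ) (2 + q)) (slotRow-head-∈-late σ₀ q Bx x<z z≤m))))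

      nOkSlots-later-∉ : ∀ σ → Bounded x σ → B x ≡ false → ∀ {p} → suc p ≤ length σ →
                         nOkSlots x (insertAt (suc p) x σ) ≡ 0
      nOkSlots-later-∉ σ@(_ ∷ _) σ-bounds Bx {p} p< =
        sum-applyUpTo-truncate {λ q → indicator (okSlot x σ′ (suc q))} {n = length σ′} z≤n λ {q} _ _ →
          cong indicator (trans (okSlot-cons σ′ (suc q) x≤m)
                                (cong (_∧ okSlot (suc x) σ′ (suc q)) (slotRow-later-∉ σ-bounds p< Bx q)))
        where σ′ = insertAt (suc p) x σ

      nOkSlots-later-∈ : ∀ σ → Bounded x σ → B x ≡ true → ∀ {p} → suc p ≤ length σ →
                         nOkSlots x (insertAt (suc p) x σ) ≡ count (okSlot (suc x) σ) (suc p)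
      nOkSlots-later-∈ σ@(_ ∷ _) σ-bounds Bx {p} p< = trans
        (sum-applyUpTo-truncate {λ q → indicator (okSlot x σ′ (suc q))} {n = length σ′}
          (subst (suc p ≤_) (sym (length-insertAt (suc p) x σ)) (m≤n⇒m≤1+n p<)) λ {q} p<q _ →
            cong indicator (trans (okSlot-cons σ′ (suc q) x≤m)
                                  (cong (_∧ okSlot (suc x) σ′ (suc q)) (slotRow-later-∈ σ-bounds p< Bx p<q))))
        (sum-applyUpTo-cong (suc p) λ {q} q<p → cong indicator (trans (okSlot-cons σ′ (suc q) x≤m) (cong₂ _∧_
          (Inserted.slotRow-below σ-bounds p< Bx q<p)
          (Inserted.okSlot-insertAt σ-bounds p< (suc q) (suc q) ≤-refl (λ r → shift-<ᵇ-≤ r q<p)))))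
        where σ′ = insertAt (suc p) x σ

      sum-admissible-insertions : ∀ σ → Bounded x σ → ∀ g →
        sum (applyUpTo (λ p → if okSlot (suc x) σ p then g (nOkSlots x (insertAt p x σ)) else 0) (suc (length σ)))
          ≡ step (B x) g (nOkSlots (suc x) σ)
      sum-admissible-insertions σ σ-bounds g = by-membership (B x) refl
        where
        v : ℕ → Bool
        v = okSlot (suc x) σ
        top : ∀ {c} → nOkSlots x (x ∷ σ) ≡ c → (if v 0 then g (nOkSlots x (x ∷ σ)) else 0) ≡ g c
        top nOk≡c = trans (cong (λ b → if b then g (nOkSlots x (x ∷ σ)) else 0) (okSlot-zero (suc x) σ)) (cong g nOk≡c)
        later : ℕ → ℕ
        later p = if v (suc p) then g (nOkSlots x (insertAt (suc p) x σ)) else 0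
        by-membership : ∀ b → B x ≡ b → (if v 0 then g (nOkSlots x (x ∷ σ)) else 0) + sum (applyUpTo later (length σ))
                                          ≡ step b g (nOkSlots (suc x) σ)
        by-membership false Bx = cong₂ _+_ (top (nOkSlots-head-∉ σ-bounds Bx)) (begin
          sum (applyUpTo later (length σ))
            ≡⟨ sum-applyUpTo-cong (length σ) (λ {p} p< →
                 trans (cong (λ n → if v (suc p) then g n else 0) (nOkSlots-later-∉ σ σ-bounds Bx p<))
                       (if-then-else-0≡indicator-* (v (suc p)) (g 0))) ⟩
          sum (applyUpTo (λ p → indicator (v (suc p)) * g 0) (length σ))
            ≡⟨ sum-applyUpTo-*ʳ (indicator ∘ v ∘ suc) (g 0) (length σ) ⟩
          nOkSlots (suc x) σ * g 0 ∎)
        by-membership true  Bx = cong₂ _+_ (top (nOkSlots-head-∈ σ σ-bounds Bx)) (begin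
          sum (applyUpTo later (length σ))
            ≡⟨ sum-applyUpTo-cong (length σ) (λ {p} p< →
                 cong (λ n → if v (suc p) then g n else 0) (nOkSlots-later-∈ σ σ-bounds Bx p<)) ⟩
          sum (applyUpTo (λ p → if v (suc p) then g (count v (suc p)) else 0) (length σ))
            ≡⟨ sum-weighted-by-count v g (length σ) ⟩
          sum (applyUpTo (g ∘ suc) (nOkSlots (suc x) σ)) ∎)

      sum-insertions : ∀ σ → Bounded x σ → ∀ g →
        sum (applyUpTo (λ p → weight x g (insertAt p x σ)) (suc (length σ)))
          ≡ (if okFrom (suc x) σ then step (B x) g (nOkSlots (suc x) σ) else 0)
      sum-insertions σ σ-bounds g =
        trans (sum-applyUpTo-cong (suc (length σ)) (λ p< → weight-insertAt (≤-pred p<))) (by-okFrom (okFrom (suc x) σ))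
        where
        term : Bool → ℕ → ℕ
        term b p = if b then g (nOkSlots x (insertAt p x σ)) else 0
        weight-insertAt : ∀ {p} → p ≤ length σ → weight x g (insertAt p x σ) ≡ term (okSlot (suc x) σ p ∧ okFrom (suc x) σ) p
        weight-insertAt {p} p≤ = cong (λ b → term b p) (Inserted.okFrom-insertAt σ-bounds p≤ x≤m)
        by-okFrom : ∀ b → sum (applyUpTo (λ p → term (okSlot (suc x) σ p ∧ b) p) (suc (length σ)))
                            ≡ (if b then step (B x) g (nOkSlots (suc x) σ) else 0)
        by-okFrom false = sum-applyUpTo-truncate {n = suc (length σ)} z≤n λ {p} _ _ →
                            cong (λ b → term b p) (∧-zeroʳ (okSlot (suc x) σ p))
        by-okFrom true  = trans (sum-applyUpTo-cong (suc (length σ)) λ {p} _ →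
                                  cong (λ b → term b p) (∧-identityʳ (okSlot (suc x) σ p)))
                                (sum-admissible-insertions σ σ-bounds g)

    weightedCount-step : ∀ {x} → x ≤ m → ∀ g → weightedCount x g ≡ weightedCount (suc x) (step (B x) g)
    weightedCount-step {x} x≤m g = begin
      sum (map (weight x g) (perms (fromTo x m)))
        ≡⟨ cong (λ xs → sum (map (weight x g) (perms xs))) (fromTo-cons x≤m) ⟩
      sum (map (weight x g) (concatMap (insertAll x) orders))
        ≡⟨ sum-concatMap (weight x g) (insertAll x) orders ⟩
      sum (map (λ σ → sum (map (weight x g) (insertAll x σ))) orders)
        ≡⟨ cong sum (map-cong-local (All.map insertions (All-perms (fromTo-bounds (suc x) m)))) ⟩
      sum (map (weight (suc x) (step (B x) g)) orders) ∎
      where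
      orders = perms (fromTo (suc x) m)
      insertions : ∀ {σ} → Bounded x σ →
                   sum (map (weight x g) (insertAll x σ)) ≡ weight (suc x) (step (B x) g) σ
      insertions {σ} σ-bounds = begin
        sum (map (weight x g) (insertAll x σ))
          ≡⟨ cong (sum ∘ map (weight x g)) (insertAll≡applyUpTo-insertAt x σ) ⟩
        sum (map (weight x g) (applyUpTo (λ p → insertAt p x σ) (suc (length σ))))
          ≡⟨ cong sum (map-applyUpTo (λ p → insertAt p x σ) (weight x g) (suc (length σ))) ⟩
        sum (applyUpTo (λ p → weight x g (insertAt p x σ)) (suc (length σ)))
          ≡⟨ sum-insertions x≤m σ σ-bounds g ⟩
        weight (suc x) (step (B x) g) σ ∎

    weightedCount-end : ∀ g → weightedCount (suc m) g ≡ g 0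
    weightedCount-end g rewrite fromTo-empty m = +-identityʳ (g 0)

    satisfies≡okFrom : ∀ σ → satisfies m B σ ≡ okFrom 1 σ
    satisfies≡okFrom σ = trans (and-concatMap _ _ (range m)) (cong and (map-cong (λ i →
      trans (and-concatMap _ _ (fromTo (suc i) m))
            (cong and (map-cong (λ j → cong and (sym (map-∘ (fromTo (suc j) m)))) (fromTo (suc i) m)))) (range m)))

    f≡weightedCount : f m B ≡ weightedCount 1 (λ _ → 1)
    f≡weightedCount = trans (length-filterᵇ (satisfies m B) (linearOrders m))
      (cong sum (map-cong (cong indicator ∘ satisfies≡okFrom) (linearOrders m)))

  f≡transfer : ∀ B m → f m B ≡ transfer B m 0
  f≡transfer B m = trans f≡weightedCount (weightedCount-transfer m 0 (+-identityʳ m))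
    where
    open SchemeCounting B m
    weightedCount-transfer : ∀ t k → t + k ≡ m → weightedCount (suc k) (transfer B k) ≡ transfer B m 0
    weightedCount-transfer zero    k k≡m = subst (λ n → weightedCount (suc n) (transfer B n) ≡ transfer B m 0) (sym k≡m)
      (weightedCount-end (transfer B m))
    weightedCount-transfer (suc t) k t+k<m = trans
      (weightedCount-step (subst (suc k ≤_) t+k<m (s≤s (m≤n+m k t))) (transfer B k))
      (weightedCount-transfer t (suc k) (trans (+-suc t k) t+k<m))

module Recurrence where

  open Sums using (sum-applyUpTo-cong)
  open Intervals using (sumFromTo≡sum-applyUpTo)
  open Transfer
  open Counting using (f≡transfer)
  open import Data.Bool using (Bool; true; false)
  open import Data.Nat using (ℕ; suc; _+_; _*_; _≤_; _<_)
  open import Data.Nat.Properties using (+-suc)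
  open import Data.Nat.GeneralisedArithmetic using (fold)
  open import Data.Nat.ListAction using (sum)
  open import Data.List using (applyUpTo)
  open import Relation.Binary.PropositionalEquality using (_≡_; sym; trans; cong; cong₂; _≗_; module ≡-Reasoning)
  open ≡-Reasoning

  module _ {B B′ : ℕ → Bool} (w : ℕ)
           (B-top : B (suc w) ≡ true) (B-above : ∀ {i} → suc w < i → B i ≡ false)
           (B′≡B : ∀ {i} → i ≤ w → B′ i ≡ B i) (B′-above : ∀ {i} → w < i → B′ i ≡ false) where

    private
      h : ℕ → ℕ
      h = transfer B′ w

      f-B : ∀ k → f (suc w + k) B ≡ fold (step∈ h) step∉ k 0
      f-B k = trans (f≡transfer B (suc w + k)) (trans (transfer-beyond (suc w) k B-above 0) (fold-step∉-cong k top 0))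
        where
        top : transfer B (suc w) ≗ step∈ h
        top c = trans (cong (λ b → step b (transfer B w) c) B-top) (step-cong true (λ c → sym (transfer-cong w B′≡B c)) c)

      f-B′ : ∀ k → f (w + k) B′ ≡ fold h step∉ k 0
      f-B′ k = trans (f≡transfer B′ (w + k)) (transfer-beyond w k B′-above 0)

    recurrence : ∀ M → f (suc w + (2 + M)) B + sum (applyUpTo (λ i → f (w + i) B′) (2 + M))
                     ≡ 2 * f (suc w + (1 + M)) B + f (w + (2 + M)) B′
    recurrence M = begin
      f (suc w + (2 + M)) B + sum (applyUpTo (λ i → f (w + i) B′) (2 + M))
        ≡⟨ cong₂ _+_ (f-B (2 + M)) (sum-applyUpTo-cong (2 + M) (λ {i} _ → f-B′ i)) ⟩
      fold (step∈ h) step∉ (2 + M) 0 + sumIterates h (2 + M)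
        ≡⟨ step∈-iterate-identity h M ⟩
      2 * fold (step∈ h) step∉ (1 + M) 0 + fold h step∉ (2 + M) 0
        ≡⟨ cong₂ (λ a r → 2 * a + r) (f-B (1 + M)) (f-B′ (2 + M)) ⟨
      2 * f (suc w + (1 + M)) B + f (w + (2 + M)) B′ ∎

    recurrence-sumFromTo : ∀ M → f (3 + (w + M)) B + sumFromTo w (suc (w + M)) (λ j → f j B′)
                               ≡ 2 * f (2 + (w + M)) B + f (2 + (w + M)) B′
    recurrence-sumFromTo M = begin
      f (3 + (w + M)) B + sumFromTo w (suc (w + M)) (λ j → f j B′)
        ≡⟨ cong₂ (λ n u → f n B + sumFromTo w u (λ j → f j B′)) (cong suc w+[2+M]) (+-suc w M) ⟨
      f (suc w + (2 + M)) B + sumFromTo w (w + suc M) (λ j → f j B′)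
        ≡⟨ cong (f (suc w + (2 + M)) B +_) (sumFromTo≡sum-applyUpTo w (suc M) (λ j → f j B′)) ⟩
      f (suc w + (2 + M)) B + sum (applyUpTo (λ i → f (w + i) B′) (2 + M))
        ≡⟨ recurrence M ⟩
      2 * f (suc w + (1 + M)) B + f (w + (2 + M)) B′
        ≡⟨ cong₂ (λ n n′ → 2 * f n B + f n′ B′) (cong suc (+-suc w M)) w+[2+M] ⟩
      2 * f (2 + (w + M)) B + f (2 + (w + M)) B′ ∎
      where
      w+[2+M] : w + (2 + M) ≡ 2 + (w + M)
      w+[2+M] = trans (+-suc w (suc M)) (cong suc (+-suc w M))

open Insertion using (≡ᵇ-false; ≡ᵇ-refl)
open Recurrence using (recurrence-sumFromTo)
open import Data.Bool using (Bool; true; false; not; _∧_)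
open import Data.Bool.Properties using (∧-identityʳ; ∧-zeroʳ)
open import Data.Product using (_×_; _,_)
open import Data.Sum using (inj₁; inj₂)
open import Data.Nat using (ℕ; _≤_; _<_; _∸_; _≡ᵇ_; _*_; s≤s)
import Data.Nat as ℕ
open import Data.Nat.Properties using (m≤n+m; m+n∸n≡m; m≤n⇒∃[o]m+o≡n; m≤n⇒m<n∨m≡n; <⇒≢; <⇒≱)
open import Data.Integer using (+_; _-_; _+_; _⊖_)
open import Data.Integer.Properties using ([+m]-[+n]≡m⊖n; ⊖-≥)
open import Relation.Binary.PropositionalEquality using (_≡_; refl; sym; trans; cong; module ≡-Reasoning)
open import Relation.Nullary using (contradiction)

m+o≡n⇒+m≡+n-+o : ∀ {m n o} → m ℕ.+ o ≡ n → + m ≡ + n - + o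
m+o≡n⇒+m≡+n-+o {m} {o = o} refl = sym (begin
  + (m ℕ.+ o) - + o  ≡⟨ [+m]-[+n]≡m⊖n (m ℕ.+ o) o ⟩
  (m ℕ.+ o) ⊖ o      ≡⟨ ⊖-≥ (m≤n+m o m) ⟩
  + (m ℕ.+ o ∸ o)    ≡⟨ cong +_ (m+n∸n≡m m o) ⟩
  + m                ∎)
  where open ≡-Reasoning

mainTheorem6 : (n : ℕ) → 2 ≤ n → (A : ℕ → Bool)
    → (∀ x → A x ≡ true → 1 ≤ x × x ≤ n)
    → (w : ℕ) → A w ≡ true → (∀ x → A x ≡ true → x ≤ w)
    → 1 < w → w < n ∸ 1
    → let A′ = λ x → A x ∧ not (x ≡ᵇ w) in
      + f n A ≡ (+ (2 * f (n ∸ 1) A) + + f (n ∸ 1) A′) - + sumFromTo (w ∸ 1) (n ∸ 2) (λ j → f j A′)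
mainTheorem6 (ℕ.suc n) _ A _ (ℕ.suc w) A-top A-max _ w<n with m≤n⇒∃[o]m+o≡n w<n
... | M , refl = m+o≡n⇒+m≡+n-+o (recurrence-sumFromTo w A-top A-above A′≡A A′-above M)
  where
  A-above : ∀ {i} → ℕ.suc w < i → A i ≡ false
  A-above {i} w<i with A i in Ai
  ... | true  = contradiction (A-max i Ai) (<⇒≱ w<i)
  ... | false = refl
  A′≡A : ∀ {i} → i ≤ w → A i ∧ not (i ≡ᵇ ℕ.suc w) ≡ A i
  A′≡A {i} i≤w = trans (cong (λ b → A i ∧ not b) (≡ᵇ-false (<⇒≢ (s≤s i≤w)))) (∧-identityʳ (A i))
  A′-above : ∀ {i} → w < i → A i ∧ not (i ≡ᵇ ℕ.suc w) ≡ false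
  A′-above {i} w<i with m≤n⇒m<n∨m≡n w<i
  ... | inj₁ w+1<i = cong (_∧ not (i ≡ᵇ ℕ.suc w)) (A-above w+1<i)
  ... | inj₂ refl  = trans (cong (λ b → A (ℕ.suc w) ∧ not b) (≡ᵇ-refl (ℕ.suc w))) (∧-zeroʳ (A (ℕ.suc w)))
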